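{- Let $d\in\mathbb{Z}$, $d>0$. Every rational solution $(x,y)\in\mathbb{Q}^2$ with $x\neq 0$, $y\neq 0$ of $$y^2=x^3-d^2x$$ is of one of the forms $$(x_1,y_1)=\left(d\,\frac{m+e}{m-e},\ \pm\frac{k}{j}\,d\,\frac{m+e}{m-e}\right),\qquad (x_2,y_2)=\left(-d\,\frac{m-e}{m+e},\ \pm\frac{k}{j}\,d\,\frac{m-e}{m+e}\right),$$ where $k,j,e,m\in\mathbb{N}$ with $m>e$, $\gcd(m,e)=1$, $\gcd(k,j)=1$, satisfy $$d=\left(\frac{k}{2j}\right)^2\frac{m^2-e^2}{em}.$$
   Context: $\mathbb{N}$ denotes the positive integers here. -}

module Defs where

open import Data.Integer using (ℤ; +_)
open import Data.Nat using (ℕ)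
open import Data.Rational using (ℚ; _/_; _÷_; 0ℚ; ≢-nonZero)
open import Data.Rational.Properties using (_≟_)
open import Relation.Nullary using (yes; no)

ℤ→ℚ : ℤ → ℚ
ℤ→ℚ z = z / 1

ℕ→ℚ : ℕ → ℚ
ℕ→ℚ n = (+ n) / 1

-- total division on ℚ (p ⊘ 0 = 0); only ever used with nonzero divisor
-- (the divisors are guaranteed nonzero by the hypotheses of the statement)
_⊘_ : ℚ → ℚ → ℚ
p ⊘ q with q ≟ 0ℚ
... | yes _ = 0ℚ
... | no q≢0 = _÷_ p q {{≢-nonZero q≢0}}

infixl 7 _⊘_

-- Let t = y / x be the slope of the line through the origin and (x, y); dividing the curve
-- equation by x gives t²x = (x + D)(x - D). Since y² = x(x + D)(x - D) > 0, either x > D or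
-- -D < x < 0. In the first case r = (x + D)/(x - D) > 1, so r = m/e in lowest terms with
-- e < m; solving for x gives x = D(m + e)/(m - e), and substituting into the slope equation
-- gives t²(m² - e²) = 4Dem, which is the formula for d once t = ±k/j in lowest terms; then
-- y = tx. The case x < 0 is the same computation for r = (D - x)/(D + x) with D and e negated.
module Submission where

open import Defs
open import Data.Nat using (ℕ; _<_)
open import Data.Nat.GCD using (gcd)
open import Data.Integer using (ℤ) renaming (_<_ to _<ℤ_; +_ to ⁺_)
open import Data.Rational using (ℚ; 0ℚ; 1ℚ; _+_; _-_; _*_; -_)
open import Data.Product using (Σ; _×_; ∃-syntax)
open import Data.Sum using (_⊎_)
open import Relation.Binary.PropositionalEquality using (_≡_; _≢_)

open import Data.Nat using (suc; z<s)
import Data.Nat.Properties as ℕ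
import Data.Integer as ℤ
import Data.Integer.Properties as ℤ
open import Data.Nat.Coprimality using (Coprime; coprime⇒gcd≡1; 1-coprimeTo)
  renaming (sym to coprime-sym)
open import Data.Rational
  using (mkℚ; 1/_; Positive; Negative; positive; negative; ≢-nonZero; toℚᵘ)
  renaming (_<_ to _<ℚ_)
open import Data.Rational.Properties
open import Data.Rational.Unnormalised as ℚᵘ using (mkℚᵘ; *≡*)
import Data.Rational.Unnormalised.Properties as ℚᵘ
open import Data.List using (_∷_; [])
open import Data.Maybe using (Maybe; just; nothing)
open import Data.Product using (_,_)
open import Data.Sum using (inj₁; inj₂)
open import Data.Empty using (⊥-elim)
open import Level using (0ℓ)
open import Function using (_∘_)
open import Relation.Binary.Definitions using (Tri; tri<; tri≈; tri>)
open import Relation.Nullary using (yes; no)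
open import Relation.Nullary.Decidable using (recompute)
open import Relation.Binary.PropositionalEquality
  using (refl; sym; trans; cong; cong₂; subst; subst₂; module ≡-Reasoning)
open import Tactic.RingSolver using (solve-∀; solve)
open import Tactic.RingSolver.Core.AlmostCommutativeRing
  using (AlmostCommutativeRing; fromCommutativeRing)

open ≡-Reasoning

ℚ-ring : AlmostCommutativeRing 0ℓ 0ℓ
ℚ-ring = fromCommutativeRing +-*-commutativeRing 0≟_
  where
  0≟_ : ∀ p → Maybe (0ℚ ≡ p)
  0≟ p with 0ℚ ≟ p
  ... | yes 0≡p = just 0≡p
  ... | no _    = nothing

pos⇒≢0 : ∀ p .{{_ : Positive p}} → p ≢ 0ℚ
pos⇒≢0 p p≡0 = <⇒≢ (positive⁻¹ p) (sym p≡0)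

*-cancelʳ-≢0 : ∀ {p q} r → r ≢ 0ℚ → p * r ≡ q * r → p ≡ q
*-cancelʳ-≢0 {p} {q} r r≢0 pr≡qr = begin
  p                ≡⟨ sym (*-identityʳ p) ⟩
  p * 1ℚ           ≡⟨ cong (p *_) (sym (*-inverseʳ r)) ⟩
  p * (r * 1/ r)   ≡⟨ sym (*-assoc p r (1/ r)) ⟩
  p * r * 1/ r     ≡⟨ cong (_* 1/ r) pr≡qr ⟩
  q * r * 1/ r     ≡⟨ *-assoc q r (1/ r) ⟩
  q * (r * 1/ r)   ≡⟨ cong (q *_) (*-inverseʳ r) ⟩
  q * 1ℚ           ≡⟨ *-identityʳ q ⟩
  q                ∎
  where instance _ = ≢-nonZero r≢0

*-≢0 : ∀ {p q} → p ≢ 0ℚ → q ≢ 0ℚ → p * q ≢ 0ℚ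
*-≢0 {p} {q} p≢0 q≢0 pq≡0 = p≢0 (*-cancelʳ-≢0 q q≢0 (trans pq≡0 (sym (*-zeroˡ q))))

≢⇒-≢0 : ∀ {p q} → p ≢ q → p - q ≢ 0ℚ
≢⇒-≢0 {p} {q} p≢q p-q≡0 = p≢q (begin
  p            ≡⟨ solve (p ∷ q ∷ []) ℚ-ring ⟩
  p - q + q    ≡⟨ cong (_+ q) p-q≡0 ⟩
  0ℚ + q       ≡⟨ +-identityˡ q ⟩
  q            ∎)

⊘-inverseʳ : ∀ p {q} → q ≢ 0ℚ → p ⊘ q * q ≡ p
⊘-inverseʳ p {q} q≢0 with q ≟ 0ℚ
... | yes q≡0 = ⊥-elim (q≢0 q≡0)
... | no q≢0′ = begin
  p * 1/ q * q     ≡⟨ *-assoc p (1/ q) q ⟩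
  p * (1/ q * q)   ≡⟨ cong (p *_) (*-inverseˡ q) ⟩
  p * 1ℚ           ≡⟨ *-identityʳ p ⟩
  p                ∎
  where instance _ = ≢-nonZero q≢0′

⊘-unique : ∀ {p q r} → q ≢ 0ℚ → p ≡ r * q → p ⊘ q ≡ r
⊘-unique {p} {q} q≢0 p≡rq = *-cancelʳ-≢0 q q≢0 (trans (⊘-inverseʳ p q≢0) p≡rq)

*≡*⇒≡*⊘ : ∀ {x} c p {q} → q ≢ 0ℚ → x * q ≡ c * p → x ≡ c * (p ⊘ q)
*≡*⇒≡*⊘ {x} c p {q} q≢0 xq≡cp = *-cancelʳ-≢0 q q≢0 (begin
  x * q              ≡⟨ xq≡cp ⟩
  c * p              ≡⟨ cong (c *_) (sym (⊘-inverseʳ p q≢0)) ⟩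
  c * (p ⊘ q * q)    ≡⟨ sym (*-assoc c (p ⊘ q) q) ⟩
  c * (p ⊘ q) * q    ∎)

⊘-cross : ∀ {a b c d} → b ≢ 0ℚ → d ≢ 0ℚ → a ⊘ b ≡ c ⊘ d → c * b ≡ a * d
⊘-cross {a} {b} {c} {d} b≢0 d≢0 a⊘b≡c⊘d = begin
  c * b              ≡⟨ cong (_* b) (sym (⊘-inverseʳ c d≢0)) ⟩
  c ⊘ d * d * b      ≡⟨ cong (λ r → r * d * b) (sym a⊘b≡c⊘d) ⟩
  a ⊘ b * d * b      ≡⟨ *-assoc (a ⊘ b) d b ⟩
  a ⊘ b * (d * b)    ≡⟨ cong (a ⊘ b *_) (*-comm d b) ⟩
  a ⊘ b * (b * d)    ≡⟨ sym (*-assoc (a ⊘ b) b d) ⟩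
  a ⊘ b * b * d      ≡⟨ cong (_* d) (⊘-inverseʳ a b≢0) ⟩
  a * d              ∎

1<⊘ : ∀ {p} q .{{_ : Positive q}} → q <ℚ p → 1ℚ <ℚ p ⊘ q
1<⊘ {p} q q<p = *-cancelʳ-<-nonNeg q {{pos⇒nonNeg q}}
  (subst₂ _<ℚ_ (sym (*-identityˡ q)) (sym (⊘-inverseʳ p (pos⇒≢0 q))) q<p)

1<⊘⇒< : ∀ {p} q .{{_ : Positive q}} → 1ℚ <ℚ p ⊘ q → q <ℚ p
1<⊘⇒< {p} q 1<p⊘q = subst₂ _<ℚ_ (*-identityˡ q) (⊘-inverseʳ p (pos⇒≢0 q))
  (*-monoˡ-<-pos q 1<p⊘q)

positive-square : ∀ {p} → p ≢ 0ℚ → Positive (p * p)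
positive-square {p} p≢0 with <-cmp p 0ℚ
... | tri< p<0 _ _ = neg*neg⇒pos p {{negative p<0}} p {{negative p<0}}
... | tri≈ _ p≡0 _ = ⊥-elim (p≢0 p≡0)
... | tri> _ _ p>0 = pos*pos⇒pos p {{positive p>0}} p {{positive p>0}}

positive-factorʳ : ∀ p q .{{_ : Positive p}} → Positive (p * q) → Positive q
positive-factorʳ p q pq>0 = positive (*-cancelˡ-<-nonNeg p {{pos⇒nonNeg p}}
  (subst (_<ℚ p * q) (sym (*-zeroʳ p)) (positive⁻¹ (p * q) {{pq>0}})))

infix 4 _≡±_

_≡±_ : ℚ → ℚ → Set
p ≡± q = p ≡ q ⊎ p ≡ - q

±-product : ∀ {p q u v} → p ≡± u → q ≡± v → p * q ≡± u * v
±-product (inj₁ refl) (inj₁ refl) = inj₁ refl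
±-product {u = u} {v} (inj₁ refl) (inj₂ refl) = inj₂ (sym (neg-distribʳ-* u v))
±-product {u = u} {v} (inj₂ refl) (inj₁ refl) = inj₂ (sym (neg-distribˡ-* u v))
±-product {u = u} {v} (inj₂ refl) (inj₂ refl) = inj₁ (solve (u ∷ v ∷ []) ℚ-ring)

±-square : ∀ {p u} → p ≡± u → p * p ≡ u * u
±-square (inj₁ refl) = refl
±-square {u = u} (inj₂ refl) = solve (u ∷ []) ℚ-ring

ℕ→ℚ-pos : ∀ {n} → 0 < n → Positive (ℕ→ℚ n)
ℕ→ℚ-pos {suc n} _ = normalize-pos (suc n) 1

ℤ→ℚ-pos : ∀ {d} → ⁺ 0 <ℤ d → Positive (ℤ→ℚ d)
ℤ→ℚ-pos {⁺ suc n} _ = normalize-pos (suc n) 1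
ℤ→ℚ-pos {⁺ 0} (ℤ.+<+ ())

ℕ→ℚ≡mkℚ : ∀ n → ℕ→ℚ n ≡ mkℚ (⁺ n) 0 (coprime-sym (1-coprimeTo n))
ℕ→ℚ≡mkℚ n = ↥p/↧p≡p (mkℚ (⁺ n) 0 (coprime-sym (1-coprimeTo n)))

ℕ→ℚ-cancel-< : ∀ {m n} → ℕ→ℚ m <ℚ ℕ→ℚ n → m < n
ℕ→ℚ-cancel-< {m} {n} m<n =
  ℤ.drop‿+<+ (subst₂ ℤ._<_ (ℤ.*-identityʳ (⁺ m)) (ℤ.*-identityʳ (⁺ n))
    (drop-*<* (subst₂ _<ℚ_ (ℕ→ℚ≡mkℚ m) (ℕ→ℚ≡mkℚ n) m<n)))

mkℚ-*-denominator : ∀ n d .(c : Coprime n (suc d)) → mkℚ (⁺ n) d c * ℕ→ℚ (suc d) ≡ ℕ→ℚ n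
mkℚ-*-denominator n d c =
  toℚᵘ-injective (ℚᵘ.≃-trans (toℚᵘ-homo-* (mkℚ (⁺ n) d c) (ℕ→ℚ (suc d)))
  (subst₂ ℚᵘ._≃_ (cong (λ q → mkℚᵘ (⁺ n) d ℚᵘ.* toℚᵘ q) (sym (ℕ→ℚ≡mkℚ (suc d))))
                 (cong toℚᵘ (sym (ℕ→ℚ≡mkℚ n)))
                 (*≡* (trans (ℤ.*-identityʳ (⁺ n ℤ.* ⁺ suc d))
                   (cong (λ k → ⁺ n ℤ.* ⁺ k) (sym (ℕ.*-identityʳ (suc d))))))))

mkℚ≡⊘ : ∀ n d .(c : Coprime n (suc d)) → mkℚ (⁺ n) d c ≡ ℕ→ℚ n ⊘ ℕ→ℚ (suc d)
mkℚ≡⊘ n d c = sym (⊘-unique (pos⇒≢0 (ℕ→ℚ (suc d)) {{ℕ→ℚ-pos {suc d} z<s}})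
                             (sym (mkℚ-*-denominator n d c)))

IsReducedFraction : ℕ → ℕ → Set
IsReducedFraction n d = 0 < n × 0 < d × gcd n d ≡ 1

mkℚ-isReducedFraction : ∀ n d .(c : Coprime (suc n) (suc d)) → IsReducedFraction (suc n) (suc d)
mkℚ-isReducedFraction n d c = z<s , z<s , recompute (gcd (suc n) (suc d) ℕ.≟ 1) (coprime⇒gcd≡1 c)

positive⇒reducedFraction : ∀ q → Positive q →
  ∃[ n ] ∃[ d ] (IsReducedFraction n d × q ≡ ℕ→ℚ n ⊘ ℕ→ℚ d)
positive⇒reducedFraction (mkℚ ℤ.+[1+ n ] d c) _ =
  suc n , suc d , mkℚ-isReducedFraction n d c , mkℚ≡⊘ (suc n) d c

≢0⇒±reducedFraction : ∀ q → q ≢ 0ℚ →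
  ∃[ n ] ∃[ d ] (IsReducedFraction n d × q ≡± ℕ→ℚ n ⊘ ℕ→ℚ d)
≢0⇒±reducedFraction q@(mkℚ (⁺ 0) _ _) q≢0 = ⊥-elim (q≢0 (↥p≡0⇒p≡0 q refl))
≢0⇒±reducedFraction (mkℚ ℤ.+[1+ n ] d c) _ =
  suc n , suc d , mkℚ-isReducedFraction n d c , inj₁ (mkℚ≡⊘ (suc n) d c)
≢0⇒±reducedFraction (mkℚ ℤ.-[1+ n ] d c) _ =
  suc n , suc d , mkℚ-isReducedFraction n d c , inj₂ (cong -_ (mkℚ≡⊘ (suc n) d c))

ratio⇒reducedFraction : ∀ {a} b .{{_ : Positive b}} → b <ℚ a →
  ∃[ m ] ∃[ e ] (IsReducedFraction m e × ℕ→ℚ e <ℚ ℕ→ℚ m × ℕ→ℚ m * b ≡ a * ℕ→ℚ e)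
ratio⇒reducedFraction {a} b b<a
  with positive⇒reducedFraction (a ⊘ b) (positive (<-trans (positive⁻¹ 1ℚ) (1<⊘ b b<a)))
... | m , e , me@(_ , e>0 , _) , a⊘b≡M⊘E =
  m , e , me , 1<⊘⇒< (ℕ→ℚ e) {{ℕ→ℚ-pos e>0}} (subst (1ℚ <ℚ_) a⊘b≡M⊘E (1<⊘ b b<a)) ,
  ⊘-cross (pos⇒≢0 b) (pos⇒≢0 (ℕ→ℚ e) {{ℕ→ℚ-pos e>0}}) a⊘b≡M⊘E

slope-form : ∀ D t {x y} → x ≢ 0ℚ → t * x ≡ y → y * y ≡ x * x * x - D * D * x →
  t * t * x ≡ (x + D) * (x - D)
slope-form D t {x} {y} x≢0 tx≡y curve = *-cancelʳ-≢0 x x≢0 (begin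
  t * t * x * x            ≡⟨ solve (x ∷ t ∷ []) ℚ-ring ⟩
  t * x * (t * x)          ≡⟨ cong₂ _*_ tx≡y tx≡y ⟩
  y * y                    ≡⟨ curve ⟩
  x * x * x - D * D * x    ≡⟨ solve (D ∷ x ∷ []) ℚ-ring ⟩
  (x + D) * (x - D) * x    ∎)

module _ (D x M E : ℚ) (ratio : M * (x - D) ≡ (x + D) * E) where

  x-from-ratio : x * (M - E) ≡ D * (M + E)
  x-from-ratio = begin
    x * (M - E)                              ≡⟨ solve (D ∷ x ∷ M ∷ E ∷ []) ℚ-ring ⟩
    M * (x - D) - (x + D) * E + D * (M + E)  ≡⟨ cong (λ r → r - (x + D) * E + D * (M + E)) ratio ⟩
    (x + D) * E - (x + D) * E + D * (M + E)  ≡⟨ solve (D ∷ x ∷ M ∷ E ∷ []) ℚ-ring ⟩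
    D * (M + E)                              ∎

  -- Multiply the curve by (M - E)²: by x(M - E) = D(M + E), (x + D)(M - E) = 2DM and
  -- (x - D)(M - E) = 2DE.
  slope²-from-ratio : ∀ t → D ≢ 0ℚ → t * t * x ≡ (x + D) * (x - D) →
    t * t * (M * M - E * E) ≡ ℕ→ℚ 4 * D * (E * M)
  slope²-from-ratio t D≢0 curve = *-cancelʳ-≢0 D D≢0 (begin
    t * t * (M * M - E * E) * D                    ≡⟨ solve (D ∷ M ∷ E ∷ t ∷ []) ℚ-ring ⟩
    t * t * (M - E) * (D * (M + E))                ≡⟨ cong (t * t * (M - E) *_) (sym x-from-ratio) ⟩
    t * t * (M - E) * (x * (M - E))                ≡⟨ solve (x ∷ M ∷ E ∷ t ∷ []) ℚ-ring ⟩
    t * t * x * ((M - E) * (M - E))                ≡⟨ cong (_* ((M - E) * (M - E))) curve ⟩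
    (x + D) * (x - D) * ((M - E) * (M - E))        ≡⟨ solve (D ∷ x ∷ M ∷ E ∷ []) ℚ-ring ⟩
    (x * (M - E) + D * (M - E)) * (x * (M - E) - D * (M - E))
      ≡⟨ cong (λ r → (r + D * (M - E)) * (r - D * (M - E))) x-from-ratio ⟩
    (D * (M + E) + D * (M - E)) * (D * (M + E) - D * (M - E))
      ≡⟨ solve (D ∷ M ∷ E ∷ []) ℚ-ring ⟩
    ℕ→ℚ 4 * D * (E * M) * D                        ∎)

-- (D, E) ↦ (-D, -E) turns this relation into the previous one and preserves t²x = x² - D².
module _ (D x M E : ℚ) (ratio : M * (D + x) ≡ (D - x) * E) where

  private
    mirrored : M * (x - - D) ≡ (x + - D) * - E
    mirrored = begin
      M * (x - - D)   ≡⟨ solve (D ∷ x ∷ M ∷ []) ℚ-ring ⟩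
      M * (D + x)     ≡⟨ ratio ⟩
      (D - x) * E     ≡⟨ solve (D ∷ x ∷ E ∷ []) ℚ-ring ⟩
      (x + - D) * - E ∎

  x-from-mirroredRatio : x * (M + E) ≡ - D * (M - E)
  x-from-mirroredRatio = begin
    x * (M + E)       ≡⟨ solve (x ∷ M ∷ E ∷ []) ℚ-ring ⟩
    x * (M - - E)     ≡⟨ x-from-ratio (- D) x M (- E) mirrored ⟩
    - D * (M + - E)   ≡⟨ solve (D ∷ M ∷ E ∷ []) ℚ-ring ⟩
    - D * (M - E)     ∎

  slope²-from-mirroredRatio : ∀ t → D ≢ 0ℚ → t * t * x ≡ (x + D) * (x - D) →
    t * t * (M * M - E * E) ≡ ℕ→ℚ 4 * D * (E * M)
  slope²-from-mirroredRatio t D≢0 curve = begin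
    t * t * (M * M - E * E)          ≡⟨ solve (M ∷ E ∷ t ∷ []) ℚ-ring ⟩
    t * t * (M * M - - E * - E)
      ≡⟨ slope²-from-ratio (- D) x M (- E) mirrored t (D≢0 ∘ neg-injective) curve′ ⟩
    ℕ→ℚ 4 * - D * (- E * M)          ≡⟨ solve (D ∷ M ∷ E ∷ []) ℚ-ring ⟩
    ℕ→ℚ 4 * D * (E * M)              ∎
    where
    curve′ : t * t * x ≡ (x + - D) * (x - - D)
    curve′ = trans curve (solve (D ∷ x ∷ []) ℚ-ring)

d-from-slope² : ∀ {D t K J M E} → J ≢ 0ℚ → E * M ≢ 0ℚ → t * t ≡ K ⊘ J * (K ⊘ J) →
  t * t * (M * M - E * E) ≡ ℕ→ℚ 4 * D * (E * M) →
  D ≡ K ⊘ (ℕ→ℚ 2 * J) * (K ⊘ (ℕ→ℚ 2 * J)) * ((M * M - E * E) ⊘ (E * M))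
d-from-slope² {D} {t} {K} {J} {M} {E} J≢0 EM≢0 t²≡w² slope² = *-cancelʳ-≢0 C C≢0 (begin
  D * C                                ≡⟨ scale D J E M ⟩
  J * J * (ℕ→ℚ 4 * D * (E * M))        ≡⟨ cong (J * J *_) (sym slope²) ⟩
  J * J * (t * t * N)                  ≡⟨ cong (λ s → J * J * (s * N)) t²≡w² ⟩
  J * J * (K ⊘ J * (K ⊘ J) * N)        ≡⟨ square-regroup J (K ⊘ J) N ⟩
  K ⊘ J * J * (K ⊘ J * J) * N          ≡⟨ cong (λ s → s * s * N) (⊘-inverseʳ K J≢0) ⟩
  K * K * N
    ≡⟨ sym (cong₂ (λ s r → s * s * r) (⊘-inverseʳ K 2J≢0) (⊘-inverseʳ N EM≢0)) ⟩
  u * 2J * (u * 2J) * (v * (E * M))    ≡⟨ sym (square-regroup′ u 2J v (E * M)) ⟩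
  u * u * v * C                        ∎)
  where
  N  = M * M - E * E
  2J = ℕ→ℚ 2 * J
  C  = 2J * 2J * (E * M)
  u  = K ⊘ 2J
  v  = N ⊘ (E * M)
  2J≢0 : 2J ≢ 0ℚ
  2J≢0 = *-≢0 (pos⇒≢0 (ℕ→ℚ 2) {{ℕ→ℚ-pos {2} z<s}}) J≢0
  C≢0 : C ≢ 0ℚ
  C≢0 = *-≢0 (*-≢0 2J≢0 2J≢0) EM≢0
  scale : ∀ D J E M → D * (ℕ→ℚ 2 * J * (ℕ→ℚ 2 * J) * (E * M)) ≡ J * J * (ℕ→ℚ 4 * D * (E * M))
  scale = solve-∀ ℚ-ring
  square-regroup : ∀ J w N → J * J * (w * w * N) ≡ w * J * (w * J) * N
  square-regroup = solve-∀ ℚ-ring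
  square-regroup′ : ∀ u a v b → u * u * v * (a * a * b) ≡ u * a * (u * a) * (v * b)
  square-regroup′ = solve-∀ ℚ-ring

Parametrised : ℚ → ℚ → ℚ → Set
Parametrised D x y = ∃[ k ] ∃[ j ] ∃[ e ] ∃[ m ]
  let K = ℕ→ℚ k; J = ℕ→ℚ j; E = ℕ→ℚ e; M = ℕ→ℚ m in
  (0 < k × 0 < j × 0 < e × 0 < m) × e < m × gcd m e ≡ 1 × gcd k j ≡ 1 ×
  D ≡ K ⊘ (ℕ→ℚ 2 * J) * (K ⊘ (ℕ→ℚ 2 * J)) * ((M * M - E * E) ⊘ (E * M)) ×
  (x ≡ D * ((M + E) ⊘ (M - E)) × y ≡± K ⊘ J * D * ((M + E) ⊘ (M - E))
   ⊎ x ≡ - (D * ((M - E) ⊘ (M + E))) × y ≡± K ⊘ J * D * ((M - E) ⊘ (M + E)))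

parametrised : ∀ {D x y t k j m e} →
  IsReducedFraction k j → t ≡± ℕ→ℚ k ⊘ ℕ→ℚ j → t * x ≡ y →
  IsReducedFraction m e → ℕ→ℚ e <ℚ ℕ→ℚ m →
  t * t * (ℕ→ℚ m * ℕ→ℚ m - ℕ→ℚ e * ℕ→ℚ e) ≡ ℕ→ℚ 4 * D * (ℕ→ℚ e * ℕ→ℚ m) →
  x * (ℕ→ℚ m - ℕ→ℚ e) ≡ D * (ℕ→ℚ m + ℕ→ℚ e) ⊎ x * (ℕ→ℚ m + ℕ→ℚ e) ≡ - D * (ℕ→ℚ m - ℕ→ℚ e) →
  Parametrised D x y
parametrised {D} {x} {y} {t} {k} {j} {m} {e}
  (k>0 , j>0 , gcd[k,j]≡1) t≡±w tx≡y (m>0 , e>0 , gcd[m,e]≡1) E<M slope² x-relation =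
  k , j , e , m , (k>0 , j>0 , e>0 , m>0) , ℕ→ℚ-cancel-< E<M , gcd[m,e]≡1 , gcd[k,j]≡1 ,
  d-from-slope² {t = t} {M = M} {E = E}
    (pos⇒≢0 J) (*-≢0 (pos⇒≢0 E) (pos⇒≢0 M)) (±-square t≡±w) slope² ,
  point x-relation
  where
  K = ℕ→ℚ k
  J = ℕ→ℚ j
  E = ℕ→ℚ e
  M = ℕ→ℚ m
  instance
    _ = ℕ→ℚ-pos j>0
    _ = ℕ→ℚ-pos e>0
    _ = ℕ→ℚ-pos m>0
  y-form : ∀ {s} → x ≡± D * s → y ≡± K ⊘ J * D * s
  y-form {s} x≡±Ds = subst₂ _≡±_ tx≡y (sym (*-assoc (K ⊘ J) D s)) (±-product t≡±w x≡±Ds)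
  point : x * (M - E) ≡ D * (M + E) ⊎ x * (M + E) ≡ - D * (M - E) →
    x ≡ D * ((M + E) ⊘ (M - E)) × y ≡± K ⊘ J * D * ((M + E) ⊘ (M - E))
    ⊎ x ≡ - (D * ((M - E) ⊘ (M + E))) × y ≡± K ⊘ J * D * ((M - E) ⊘ (M + E))
  point (inj₁ x[M-E]≡D[M+E]) = inj₁ (x≡ , y-form (inj₁ x≡))
    where
    x≡ : x ≡ D * ((M + E) ⊘ (M - E))
    x≡ = *≡*⇒≡*⊘ D (M + E) (≢⇒-≢0 (<⇒≢ E<M ∘ sym)) x[M-E]≡D[M+E]
  point (inj₂ x[M+E]≡-D[M-E]) = inj₂ (x≡ , y-form (inj₂ x≡))
    where
    x≡ : x ≡ - (D * ((M - E) ⊘ (M + E)))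
    x≡ = trans (*≡*⇒≡*⊘ (- D) (M - E) (pos⇒≢0 (M + E) {{pos+pos⇒pos M E}}) x[M+E]≡-D[M-E])
               (sym (neg-distribˡ-* D ((M - E) ⊘ (M + E))))

module _ {D x y t : ℚ} (D>0 : Positive D) (x≢0 : x ≢ 0ℚ) (y≢0 : y ≢ 0ℚ)
         (curve : y * y ≡ x * x * x - D * D * x) (tx≡y : t * x ≡ y) where

  private
    instance _ = D>0

    t≢0 : t ≢ 0ℚ
    t≢0 t≡0 = y≢0 (trans (sym tx≡y) (trans (cong (_* x) t≡0) (*-zeroˡ x)))

    slope-curve : t * t * x ≡ (x + D) * (x - D)
    slope-curve = slope-form D t x≢0 tx≡y curve

    y²>0 : Positive (y * y)
    y²>0 = positive-square y≢0

    x-D>0 : Positive x → Positive (x - D)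
    x-D>0 x>0 = positive-factorʳ (x * (x + D)) (x - D)
      {{pos*pos⇒pos x {{x>0}} (x + D) {{x+D>0}}}} (subst Positive y²≡ y²>0)
      where
      y²≡ : y * y ≡ x * (x + D) * (x - D)
      y²≡ = trans curve (solve (D ∷ x ∷ []) ℚ-ring)
      x+D>0 = pos+pos⇒pos x {{x>0}} D

    D+x>0 : Negative x → Positive (D + x)
    D+x>0 x<0 = positive-factorʳ (x * (x - D)) (D + x)
      {{neg*neg⇒pos x {{x<0}} (x - D) {{x-D<0}}}} (subst Positive y²≡ y²>0)
      where
      y²≡ : y * y ≡ x * (x - D) * (D + x)
      y²≡ = trans curve (solve (D ∷ x ∷ []) ℚ-ring)
      x-D<0 = neg+neg⇒neg x {{x<0}} (- D) {{neg-pos {D} D>0}}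

    positive-x-case : ∀ {k j} → IsReducedFraction k j → t ≡± ℕ→ℚ k ⊘ ℕ→ℚ j →
      Positive x → Parametrised D x y
    positive-x-case kj t≡±w x>0 =
      let m , e , me , E<M , ratio = ratio⇒reducedFraction (x - D) {{x-D>0 x>0}} x-D<x+D
          M = ℕ→ℚ m; E = ℕ→ℚ e in
      parametrised kj t≡±w tx≡y me E<M
        (slope²-from-ratio D x M E ratio t (pos⇒≢0 D) slope-curve) (inj₁ (x-from-ratio D x M E ratio))
      where
      x-D<x+D : x - D <ℚ x + D
      x-D<x+D = +-monoʳ-< x (neg<pos (- D) D {{neg-pos {D} D>0}})

    negative-x-case : ∀ {k j} → IsReducedFraction k j → t ≡± ℕ→ℚ k ⊘ ℕ→ℚ j →
      Negative x → Parametrised D x y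
    negative-x-case kj t≡±w x<0 =
      let m , e , me , E<M , ratio = ratio⇒reducedFraction (D + x) {{D+x>0 x<0}} D+x<D-x
          M = ℕ→ℚ m; E = ℕ→ℚ e in
      parametrised kj t≡±w tx≡y me E<M
        (slope²-from-mirroredRatio D x M E ratio t (pos⇒≢0 D) slope-curve) (inj₂ (x-from-mirroredRatio D x M E ratio))
      where
      D+x<D-x : D + x <ℚ D - x
      D+x<D-x = +-monoʳ-< D (<-trans x<0′ (neg-antimono-< x<0′))
        where x<0′ = negative⁻¹ x {{x<0}}

    by-sign : ∀ {k j} → IsReducedFraction k j → t ≡± ℕ→ℚ k ⊘ ℕ→ℚ j →
      Tri (x <ℚ 0ℚ) (x ≡ 0ℚ) (0ℚ <ℚ x) → Parametrised D x y
    by-sign kj t≡±w (tri< x<0 _ _) = negative-x-case kj t≡±w (negative x<0)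
    by-sign _  _    (tri≈ _ x≡0 _) = ⊥-elim (x≢0 x≡0)
    by-sign kj t≡±w (tri> _ _ x>0) = positive-x-case kj t≡±w (positive x>0)

  slope⇒parametrised : Parametrised D x y
  slope⇒parametrised =
    let _ , _ , kj , t≡±w = ≢0⇒±reducedFraction t t≢0 in by-sign kj t≡±w (<-cmp x 0ℚ)

lemma2 : (d : ℤ) → ⁺ 0 <ℤ d → (x y : ℚ) → x ≢ 0ℚ → y ≢ 0ℚ →
    y * y ≡ x * x * x - ℤ→ℚ d * ℤ→ℚ d * x →
    ∃[ k ] ∃[ j ] ∃[ e ] ∃[ m ]
      ((0 < k × 0 < j × 0 < e × 0 < m) × e < m × gcd m e ≡ 1 × gcd k j ≡ 1 ×
       ℤ→ℚ d ≡ (ℕ→ℚ k ⊘ (ℕ→ℚ 2 * ℕ→ℚ j)) * (ℕ→ℚ k ⊘ (ℕ→ℚ 2 * ℕ→ℚ j))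
                 * ((ℕ→ℚ m * ℕ→ℚ m - ℕ→ℚ e * ℕ→ℚ e) ⊘ (ℕ→ℚ e * ℕ→ℚ m)) ×
       ((x ≡ ℤ→ℚ d * ((ℕ→ℚ m + ℕ→ℚ e) ⊘ (ℕ→ℚ m - ℕ→ℚ e)) ×
           (y ≡ (ℕ→ℚ k ⊘ ℕ→ℚ j) * ℤ→ℚ d * ((ℕ→ℚ m + ℕ→ℚ e) ⊘ (ℕ→ℚ m - ℕ→ℚ e))
            ⊎ y ≡ - ((ℕ→ℚ k ⊘ ℕ→ℚ j) * ℤ→ℚ d * ((ℕ→ℚ m + ℕ→ℚ e) ⊘ (ℕ→ℚ m - ℕ→ℚ e)))))
        ⊎
        (x ≡ - (ℤ→ℚ d * ((ℕ→ℚ m - ℕ→ℚ e) ⊘ (ℕ→ℚ m + ℕ→ℚ e))) ×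
           (y ≡ (ℕ→ℚ k ⊘ ℕ→ℚ j) * ℤ→ℚ d * ((ℕ→ℚ m - ℕ→ℚ e) ⊘ (ℕ→ℚ m + ℕ→ℚ e))
            ⊎ y ≡ - ((ℕ→ℚ k ⊘ ℕ→ℚ j) * ℤ→ℚ d * ((ℕ→ℚ m - ℕ→ℚ e) ⊘ (ℕ→ℚ m + ℕ→ℚ e)))))))
lemma2 d d>0 x y x≢0 y≢0 curve =
  slope⇒parametrised {t = y ⊘ x} (ℤ→ℚ-pos d>0) x≢0 y≢0 curve (⊘-inverseʳ y x≢0)
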